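{- Let $(a_n)_{n\ge1}$ be a non-periodic E-sequence such that $\limsup_{n\to\infty}\frac{b_n}{n}>\log_2 3$, where $b_n=\sum_{i=1}^n a_i$. Then $(a_n)$ is $\Omega$-divergent.
   Context: An E-sequence is any infinite sequence $(a_n)_{n\ge1}$ of positive integers. For an odd positive integer $x$, its trajectory $(x_n)_{n\ge0}$ and its E-sequence $(a_n)_{n\ge1}$ are defined by $x_0=x$ and, for $n\ge1$, $x_n=\frac{3x_{n-1}+1}{2^{a_n}}$, where $a_n$ is the exponent of the largest power of $2$ dividing $3x_{n-1}+1$. An E-sequence is $\Omega$-divergent if it is not the E-sequence of any odd positive integer. An E-sequence is periodic if there are integers $l\ge0$, $r\ge1$ with $a_n=a_{n+r}$ for all $n>l$; otherwise it is non-periodic. -}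

module Defs where

open import Data.Nat using (ℕ; zero; suc; _+_; _*_; _^_; _≤_; _<_)
open import Data.Nat.Divisibility using (_∣_)
open import Data.Nat.DivMod using (_%_)
open import Data.Product using (Σ; _×_; ∃; ∃-syntax)
open import Relation.Nullary using (¬_)
open import Relation.Binary.PropositionalEquality using (_≡_)

-- Sequences are functions ℕ → ℕ using the paper's indexing a 1, a 2, ...;
-- the value a 0 is irrelevant and never inspected.

IsESequence : (ℕ → ℕ) → Set
IsESequence a = ∀ n → 1 ≤ n → 1 ≤ a n

IsPeriodic : (ℕ → ℕ) → Set
IsPeriodic a = ∃[ l ] ∃[ r ] (1 ≤ r × (∀ n → l < n → a n ≡ a (n + r)))

NonPeriodic : (ℕ → ℕ) → Set
NonPeriodic a = ¬ IsPeriodic a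

partialSum : (ℕ → ℕ) → ℕ → ℕ
partialSum a zero = 0
partialSum a (suc n) = partialSum a n + a (suc n)

Odd : ℕ → Set
Odd x = x % 2 ≡ 1

IsTrajectory : ℕ → (ℕ → ℕ) → (ℕ → ℕ) → Set
IsTrajectory x xs a =
  xs 0 ≡ x ×
  (∀ n → (2 ^ a (suc n) ∣ 3 * xs n + 1)
       × ¬ (2 ^ (a (suc n) + 1) ∣ 3 * xs n + 1)
       × (xs (suc n) * 2 ^ a (suc n) ≡ 3 * xs n + 1))

IsESequenceOf : ℕ → (ℕ → ℕ) → Set
IsESequenceOf x a = ∃[ xs ] IsTrajectory x xs a

ΩDivergent : (ℕ → ℕ) → Set
ΩDivergent a = ¬ (∃[ x ] (1 ≤ x × Odd x × IsESequenceOf x a))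

-- limsup_{n→∞} b_n / n > log₂ 3, expressed without reals:
-- there is a rational p/q > log₂ 3 (i.e. 3^q < 2^p, q ≥ 1) such that
-- b_n / n > p / q (i.e. p·n < q·b_n) for infinitely many n ≥ 1.
LimsupAboveLog₂3 : (ℕ → ℕ) → Set
LimsupAboveLog₂3 a =
  ∃[ p ] ∃[ q ] (1 ≤ q × 3 ^ q < 2 ^ p ×
    (∀ N → ∃[ n ] (N ≤ n × 1 ≤ n × p * n < q * partialSum a n)))

module Submission where

-- Proof idea.  Suppose an odd x had the E-sequence a, with trajectory (x_n)
-- and partial sums b_n, and fix p/q > log₂ 3 with p·n < q·b_n infinitely often.
--
-- 1. One Collatz step x ↦ (e, y) is a function of x, since the exponent of 2
--    in 3x + 1 is unique.  So a repetition x_i = x_{i+r} would make a periodic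
--    after i; as a is non-periodic, the trajectory is injective, and hence
--    (up to double negation, enough since we prove ⊥) eventually x_n ≥ M for
--    any prescribed M.
-- 2. For the scaled trajectory P_n = x_n·2^{b_n} one has P_{n+1} = (3x_n+1)·2^{b_n},
--    so x_n ≥ M for n ≥ N₀ gives M^k·P_{N₀+k} ≤ (3M+1)^k·P_{N₀}.
-- 3. For M = 1 + q·4^{q-1} we have A := (3M+1)^q < B := 2^p·M^q.  At an index
--    n = N₀ + k with p·n < q·b_n, raising step 2 to the q-th power gives
--    B^k ≤ A^k·C with C = P_{N₀}^q, which Bernoulli's inequality refutes as
--    soon as k ≥ A·C.

open import Defs
open import Data.Nat using (ℕ; zero; suc; _+_; _*_; _∸_; _^_; _≤_; _<_; z≤n; s≤s; >-nonZero)
open import Data.Nat.Properties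
open import Data.Nat.Divisibility using (_∣_; ∣-trans; m∣m*n)
open import Data.Nat.Tactic.RingSolver using (solve-∀)
open import Data.Product using (_×_; ∃-syntax; _,_; proj₁; proj₂)
open import Data.Empty using (⊥; ⊥-elim)
open import Relation.Nullary using (¬_; yes; no)
open import Relation.Nullary.Decidable using (¬¬-excluded-middle)
open import Relation.Binary.Definitions using (tri<; tri≈; tri>)
open import Relation.Binary.PropositionalEquality

*-^-distrib : ∀ m n k → (m * n) ^ k ≡ m ^ k * n ^ k
*-^-distrib m n zero = refl
*-^-distrib m n (suc k) = begin
  m * n * (m * n) ^ k      ≡⟨ cong (m * n *_) (*-^-distrib m n k) ⟩
  m * n * (m ^ k * n ^ k)  ≡⟨ regroup m n (m ^ k) (n ^ k) ⟩
  m * m ^ k * (n * n ^ k)  ∎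
  where
  open ≡-Reasoning
  regroup : ∀ a b c d → a * b * (c * d) ≡ a * c * (b * d)
  regroup = solve-∀

^-swap : ∀ m i j → (m ^ i) ^ j ≡ (m ^ j) ^ i
^-swap m i j = begin
  (m ^ i) ^ j  ≡⟨ ^-*-assoc m i j ⟩
  m ^ (i * j)  ≡⟨ cong (m ^_) (*-comm i j) ⟩
  m ^ (j * i)  ≡⟨ ^-*-assoc m j i ⟨
  (m ^ j) ^ i  ∎
  where open ≡-Reasoning

^-∣-mono : ∀ m {i j} → i ≤ j → m ^ i ∣ m ^ j
^-∣-mono m {i} {j} i≤j = subst (m ^ i ∣_) split (m∣m*n (m ^ (j ∸ i)))
  where
  split : m ^ i * m ^ (j ∸ i) ≡ m ^ j
  split = trans (sym (^-distribˡ-+-* m i (j ∸ i))) (cong (m ^_) (m+[n∸m]≡n i≤j))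

binomial-tail : ∀ y s → (y + 1) ^ suc s ≤ y ^ suc s + suc s * (y + 1) ^ s
binomial-tail y zero = ≤-reflexive (base y)
  where
  base : ∀ y → (y + 1) * 1 ≡ y * 1 + 1 * 1
  base = solve-∀
binomial-tail y (suc s) = begin
  (y + 1) * (y + 1) ^ suc s
    ≤⟨ *-monoʳ-≤ (y + 1) (binomial-tail y s) ⟩
  (y + 1) * (y ^ suc s + suc s * (y + 1) ^ s)
    ≡⟨ expand y (y ^ suc s) ((y + 1) ^ s) s ⟩
  y * y ^ suc s + (y ^ suc s + suc s * (y + 1) ^ suc s)
    ≤⟨ +-monoʳ-≤ (y * y ^ suc s) (+-monoˡ-≤ _ (^-monoˡ-≤ (suc s) (m≤m+n y 1))) ⟩
  y ^ suc (suc s) + suc (suc s) * (y + 1) ^ suc s ∎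
  where
  open ≤-Reasoning
  expand : ∀ y Y Z s → (y + 1) * (Y + suc s * Z) ≡ y * Y + (Y + suc s * ((y + 1) * Z))
  expand = solve-∀

bernoulli : ∀ A k → A ^ k * (A + k) ≤ A * (A + 1) ^ k
bernoulli A zero = ≤-reflexive (base A)
  where
  base : ∀ A → 1 * (A + 0) ≡ A * 1
  base = solve-∀
bernoulli A (suc k) = begin
  A * A ^ k * (A + suc k)       ≡⟨ swap₁ A (A ^ k) (A + suc k) ⟩
  A ^ k * (A * (A + suc k))     ≤⟨ *-monoʳ-≤ (A ^ k) (subst (A * (A + suc k) ≤_) (sym (step A k)) (m≤m+n _ k)) ⟩
  A ^ k * ((A + 1) * (A + k))   ≡⟨ swap₂ (A ^ k) (A + 1) (A + k) ⟩
  (A + 1) * (A ^ k * (A + k))   ≤⟨ *-monoʳ-≤ (A + 1) (bernoulli A k) ⟩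
  (A + 1) * (A * (A + 1) ^ k)   ≡⟨ swap₂ (A + 1) A ((A + 1) ^ k) ⟩
  A * ((A + 1) * (A + 1) ^ k)   ∎
  where
  open ≤-Reasoning
  swap₁ : ∀ a x y → a * x * y ≡ x * (a * y)
  swap₁ = solve-∀
  swap₂ : ∀ x y z → x * (y * z) ≡ y * (x * z)
  swap₂ = solve-∀
  step : ∀ A k → (A + 1) * (A + k) ≡ A * (A + suc k) + k
  step = solve-∀

geometric-gap : ∀ {A B C k} → 0 < A → A < B → A * C ≤ k → B ^ k ≤ A ^ k * C → ⊥
geometric-gap {A} {B} {C} {k} 0<A A<B AC≤k Bᵏ≤AᵏC =
  <-irrefl refl (begin-strict
    k      <⟨ m<n+m k 0<A ⟩
    A + k  ≤⟨ *-cancelˡ-≤ (A ^ k) {{m^n≢0 A k {{>-nonZero 0<A}}}} scaled ⟩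
    A * C  ≤⟨ AC≤k ⟩
    k      ∎)
  where
  open ≤-Reasoning
  swap : ∀ a x c → a * (x * c) ≡ x * (a * c)
  swap = solve-∀
  scaled : A ^ k * (A + k) ≤ A ^ k * (A * C)
  scaled = begin
    A ^ k * (A + k)     ≤⟨ bernoulli A k ⟩
    A * (A + 1) ^ k     ≤⟨ *-monoʳ-≤ A (^-monoˡ-≤ k (subst (_≤ B) (+-comm 1 A) A<B)) ⟩
    A * B ^ k           ≤⟨ *-monoʳ-≤ A Bᵏ≤AᵏC ⟩
    A * (A ^ k * C)     ≡⟨ swap A (A ^ k) C ⟩
    A ^ k * (A * C)     ∎

-- The threshold M = 1 + q·4^{q-1} for q = s + 1.  If 3^q < 2^p then
-- (3M+1)^q < 2^p·M^q, i.e. the ratio (3M+1)/M is below 2^{p/q}.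
threshold : ℕ → ℕ
threshold s = suc (suc s * 4 ^ s)

threshold-gap : ∀ s p → 3 ^ suc s < 2 ^ p →
  (3 * threshold s + 1) ^ suc s < 2 ^ p * threshold s ^ suc s
threshold-gap s p 3^q<2^p = begin-strict
  (3 * M + 1) ^ suc s
    ≤⟨ binomial-tail (3 * M) s ⟩
  (3 * M) ^ suc s + suc s * (3 * M + 1) ^ s
    ≤⟨ +-monoʳ-≤ ((3 * M) ^ suc s) (*-monoʳ-≤ (suc s) (^-monoˡ-≤ s 3M+1≤4M)) ⟩
  (3 * M) ^ suc s + suc s * (4 * M) ^ s
    ≡⟨ cong₂ (λ u v → u + suc s * v) (*-^-distrib 3 M (suc s)) (*-^-distrib 4 M s) ⟩
  3 ^ suc s * M ^ suc s + suc s * (4 ^ s * M ^ s)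
    ≡⟨ cong (3 ^ suc s * M ^ suc s +_) (sym (*-assoc (suc s) (4 ^ s) (M ^ s))) ⟩
  3 ^ suc s * M ^ suc s + suc s * 4 ^ s * M ^ s
    <⟨ +-monoʳ-< (3 ^ suc s * M ^ suc s) (*-monoˡ-< (M ^ s) {{m^n≢0 M s}} {suc s * 4 ^ s} ≤-refl) ⟩
  3 ^ suc s * M ^ suc s + M ^ suc s
    ≡⟨ cong (3 ^ suc s * M ^ suc s +_) (*-identityˡ (M ^ suc s)) ⟨
  3 ^ suc s * M ^ suc s + 1 * M ^ suc s
    ≡⟨ *-distribʳ-+ (M ^ suc s) (3 ^ suc s) 1 ⟨
  (3 ^ suc s + 1) * M ^ suc s
    ≤⟨ *-monoˡ-≤ (M ^ suc s) (subst (_≤ 2 ^ p) (+-comm 1 (3 ^ suc s)) 3^q<2^p) ⟩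
  2 ^ p * M ^ suc s ∎
  where
  open ≤-Reasoning
  M = threshold s
  3M+1≤4M : 3 * M + 1 ≤ 4 * M
  3M+1≤4M = subst (3 * M + 1 ≤_) (solve-4M M) (+-monoʳ-≤ (3 * M) (s≤s z≤n))
    where
    solve-4M : ∀ M → 3 * M + M ≡ 4 * M
    solve-4M = solve-∀

good-index-bound : ∀ p q M k n b x → 1 ≤ x → k ≤ n → p * n ≤ q * b →
  (2 ^ p * M ^ q) ^ k ≤ (M ^ k * (x * 2 ^ b)) ^ q
good-index-bound p q M k n b x 1≤x k≤n pn≤qb = begin
  (2 ^ p * M ^ q) ^ k         ≡⟨ *-^-distrib (2 ^ p) (M ^ q) k ⟩
  (2 ^ p) ^ k * (M ^ q) ^ k   ≡⟨ cong₂ _*_ (^-*-assoc 2 p k) (^-swap M q k) ⟩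
  2 ^ (p * k) * (M ^ k) ^ q   ≤⟨ *-monoˡ-≤ _ (^-monoʳ-≤ 2 (≤-trans (*-monoʳ-≤ p k≤n) pn≤qb)) ⟩
  2 ^ (q * b) * (M ^ k) ^ q   ≡⟨ cong (λ e → 2 ^ e * (M ^ k) ^ q) (*-comm q b) ⟩
  2 ^ (b * q) * (M ^ k) ^ q   ≡⟨ cong (_* (M ^ k) ^ q) (^-*-assoc 2 b q) ⟨
  (2 ^ b) ^ q * (M ^ k) ^ q   ≤⟨ *-monoˡ-≤ _ (^-monoˡ-≤ q (m≤n*m (2 ^ b) x {{>-nonZero 1≤x}})) ⟩
  (x * 2 ^ b) ^ q * (M ^ k) ^ q  ≡⟨ *-comm _ ((M ^ k) ^ q) ⟩
  (M ^ k) ^ q * (x * 2 ^ b) ^ q  ≡⟨ *-^-distrib (M ^ k) (x * 2 ^ b) q ⟨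
  (M ^ k * (x * 2 ^ b)) ^ q   ∎
  where open ≤-Reasoning

injective-eventually-large : ∀ (f : ℕ → ℕ) → (∀ {i j} → i < j → f i ≢ f j) →
  ∀ m → ¬ ¬ (∃[ N ] (∀ n → N ≤ n → m ≤ f n))
injective-eventually-large f inj zero k = k (0 , λ _ _ → z≤n)
injective-eventually-large f inj (suc m) k =
  injective-eventually-large f inj m λ { (N , large) →
    ¬¬-excluded-middle {A = ∃[ n ] (N ≤ n × f n ≡ m)} λ
      -- if m is attained at some n ≥ N, it is never attained again after n
      { (yes (n , N≤n , fₙ≡m)) → k (suc n , λ n′ n<n′ →
          ≤∧≢⇒< (large n′ (≤-trans N≤n (<⇒≤ n<n′))) (λ m≡fₙ′ → inj n<n′ (trans fₙ≡m m≡fₙ′)))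
      ; (no never) → k (N , λ n′ N≤n′ →
          ≤∧≢⇒< (large n′ N≤n′) (λ m≡fₙ′ → never (n′ , N≤n′ , sym m≡fₙ′))) } }

exact-exponent-unique : ∀ m {e e′ y} →
  m ^ e ∣ y → ¬ (m ^ (e + 1) ∣ y) → m ^ e′ ∣ y → ¬ (m ^ (e′ + 1) ∣ y) → e ≡ e′
exact-exponent-unique m {e} {e′} e∣ e+1∤ e′∣ e′+1∤ with <-cmp e e′
... | tri< e<e′ _ _ = ⊥-elim (e+1∤ (∣-trans (^-∣-mono m (subst (_≤ e′) (+-comm 1 e) e<e′)) e′∣))
... | tri≈ _ e≡e′ _ = e≡e′
... | tri> _ _ e′<e = ⊥-elim (e′+1∤ (∣-trans (^-∣-mono m (subst (_≤ e) (+-comm 1 e′) e′<e)) e∣))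

CollatzStep : ℕ → ℕ → ℕ → Set
CollatzStep x e y =
  (2 ^ e ∣ 3 * x + 1) × ¬ (2 ^ (e + 1) ∣ 3 * x + 1) × (y * 2 ^ e ≡ 3 * x + 1)

collatzStep-unique : ∀ {x e y e′ y′} → CollatzStep x e y → CollatzStep x e′ y′ → e ≡ e′ × y ≡ y′
collatzStep-unique {e = e} {y} {e′} {y′} (e∣ , e+1∤ , y-eq) (e′∣ , e′+1∤ , y′-eq) =
  e≡e′ , *-cancelʳ-≡ y y′ (2 ^ e) {{m^n≢0 2 e}}
           (trans y-eq (trans (sym y′-eq) (cong (λ f → y′ * 2 ^ f) (sym e≡e′))))
  where
  e≡e′ : e ≡ e′
  e≡e′ = exact-exponent-unique 2 e∣ e+1∤ e′∣ e′+1∤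

step-growth : ∀ {M x e y} → M ≤ x → CollatzStep x e y → M * (y * 2 ^ e) ≤ (3 * M + 1) * x
step-growth {M} {x} {e} {y} M≤x (_ , _ , y-eq) = begin
  M * (y * 2 ^ e)   ≡⟨ cong (M *_) y-eq ⟩
  M * (3 * x + 1)   ≡⟨ expandˡ M x ⟩
  3 * M * x + M     ≤⟨ +-monoʳ-≤ (3 * M * x) M≤x ⟩
  3 * M * x + x     ≡⟨ expandʳ M x ⟨
  (3 * M + 1) * x   ∎
  where
  open ≤-Reasoning
  expandˡ : ∀ M x → M * (3 * x + 1) ≡ 3 * M * x + M
  expandˡ = solve-∀
  expandʳ : ∀ M x → (3 * M + 1) * x ≡ 3 * M * x + x
  expandʳ = solve-∀

Orbit : (ℕ → ℕ) → (ℕ → ℕ) → Set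
Orbit xs a = ∀ n → CollatzStep (xs n) (a (suc n)) (xs (suc n))

scaledOrbit : (ℕ → ℕ) → (ℕ → ℕ) → ℕ → ℕ
scaledOrbit xs a n = xs n * 2 ^ partialSum a n

module _ {xs a : ℕ → ℕ} (orbit : Orbit xs a) where

  orbit-step : ∀ {i j} → xs i ≡ xs j → a (suc i) ≡ a (suc j) × xs (suc i) ≡ xs (suc j)
  orbit-step {i} {j} xᵢ≡xⱼ = collatzStep-unique {x = xs i} (orbit i)
    (subst (λ z → CollatzStep z (a (suc j)) (xs (suc j))) (sym xᵢ≡xⱼ) (orbit j))

  orbit-shift : ∀ {i j} → xs i ≡ xs j → ∀ t → xs (i + t) ≡ xs (j + t)
  orbit-shift {i} {j} xᵢ≡xⱼ zero rewrite +-identityʳ i | +-identityʳ j = xᵢ≡xⱼ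
  orbit-shift {i} {j} xᵢ≡xⱼ (suc t) rewrite +-suc i t | +-suc j t =
    proj₂ (orbit-step (orbit-shift xᵢ≡xⱼ t))

  -- A repetition xs i = xs (i + r) with r ≥ 1 makes a periodic after i; so for
  -- a non-periodic a the orbit never repeats a value.
  orbit-injective : NonPeriodic a → ∀ {i j} → i < j → xs i ≢ xs j
  orbit-injective nonPeriodic {i} i<j xᵢ≡xⱼ with m≤n⇒∃[o]m+o≡n i<j
  ... | d , refl = nonPeriodic (i , suc d , s≤s z≤n , periodic)
    where
    repeat : xs i ≡ xs (i + suc d)
    repeat = trans xᵢ≡xⱼ (cong xs (sym (+-suc i d)))
    reorder : ∀ i r t → i + r + t ≡ i + t + r
    reorder = solve-∀
    periodic : ∀ n → i < n → a n ≡ a (n + suc d)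
    periodic n i<n with m≤n⇒∃[o]m+o≡n i<n
    ... | t , refl = trans (proj₁ (orbit-step (orbit-shift repeat t)))
                           (cong (λ m → a (suc m)) (reorder i (suc d) t))

  private
    P : ℕ → ℕ
    P = scaledOrbit xs a

  scaled-step : ∀ {M} n → M ≤ xs n → M * P (suc n) ≤ (3 * M + 1) * P n
  scaled-step {M} n M≤xₙ = begin
    M * (xs (suc n) * 2 ^ (b + e))        ≡⟨ cong (λ z → M * (xs (suc n) * z)) (^-distribˡ-+-* 2 b e) ⟩
    M * (xs (suc n) * (2 ^ b * 2 ^ e))    ≡⟨ regroup M (xs (suc n)) (2 ^ b) (2 ^ e) ⟩
    M * (xs (suc n) * 2 ^ e) * 2 ^ b      ≤⟨ *-monoˡ-≤ (2 ^ b) (step-growth {x = xs n} {e} {xs (suc n)} M≤xₙ (orbit n)) ⟩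
    (3 * M + 1) * xs n * 2 ^ b            ≡⟨ *-assoc (3 * M + 1) (xs n) (2 ^ b) ⟩
    (3 * M + 1) * (xs n * 2 ^ b)          ∎
    where
    open ≤-Reasoning
    b = partialSum a n
    e = a (suc n)
    regroup : ∀ m y u v → m * (y * (u * v)) ≡ m * (y * v) * u
    regroup = solve-∀

  scaled-growth : ∀ {M N₀} → (∀ n → N₀ ≤ n → M ≤ xs n) →
    ∀ k → M ^ k * P (N₀ + k) ≤ (3 * M + 1) ^ k * P N₀
  scaled-growth {M} {N₀} large zero rewrite +-identityʳ N₀ = ≤-refl
  scaled-growth {M} {N₀} large (suc k) rewrite +-suc N₀ k = begin
    M * M ^ k * P (suc (N₀ + k))               ≡⟨ swap₁ M (M ^ k) (P (suc (N₀ + k))) ⟩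
    M ^ k * (M * P (suc (N₀ + k)))             ≤⟨ *-monoʳ-≤ (M ^ k) (scaled-step (N₀ + k) (large (N₀ + k) (m≤m+n N₀ k))) ⟩
    M ^ k * ((3 * M + 1) * P (N₀ + k))         ≡⟨ swap₂ (M ^ k) (3 * M + 1) (P (N₀ + k)) ⟩
    (3 * M + 1) * (M ^ k * P (N₀ + k))         ≤⟨ *-monoʳ-≤ (3 * M + 1) (scaled-growth large k) ⟩
    (3 * M + 1) * ((3 * M + 1) ^ k * P N₀)     ≡⟨ *-assoc (3 * M + 1) _ _ ⟨
    (3 * M + 1) * (3 * M + 1) ^ k * P N₀       ∎
    where
    open ≤-Reasoning
    swap₁ : ∀ a x y → a * x * y ≡ x * (a * y)
    swap₁ = solve-∀
    swap₂ : ∀ x y z → x * (y * z) ≡ y * (x * z)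
    swap₂ = solve-∀

  -- If the orbit eventually stays ≥ M ≥ 1, where (3M+1)^q < 2^p·M^q, then
  -- p·n < q·b_n cannot hold infinitely often: at such an index n = N₀ + k
  -- with k ≥ A·C, good-index-bound and scaled-growth give B^k ≤ A^k·C.
  eventually-large-contradiction : ∀ {M p q N₀} → 1 ≤ M → (3 * M + 1) ^ q < 2 ^ p * M ^ q →
    (∀ n → N₀ ≤ n → M ≤ xs n) →
    (∀ N → ∃[ n ] (N ≤ n × 1 ≤ n × p * n < q * partialSum a n)) → ⊥
  eventually-large-contradiction {M} {p} {q} {N₀} 1≤M A<B large often
    with often (N₀ + (3 * M + 1) ^ q * P N₀ ^ q)
  ... | n , N≤n , _ , pn<qb with m≤n⇒∃[o]m+o≡n (≤-trans (m≤m+n N₀ _) N≤n)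
  ... | k , refl = geometric-gap 0<A A<B (+-cancelˡ-≤ N₀ _ _ N≤n) (begin
    (2 ^ p * M ^ q) ^ k                  ≤⟨ good-index-bound p q M k (N₀ + k) _ _ 1≤xₙ (m≤n+m k N₀) (<⇒≤ pn<qb) ⟩
    (M ^ k * P (N₀ + k)) ^ q             ≤⟨ ^-monoˡ-≤ q (scaled-growth large k) ⟩
    ((3 * M + 1) ^ k * P N₀) ^ q         ≡⟨ *-^-distrib ((3 * M + 1) ^ k) (P N₀) q ⟩
    ((3 * M + 1) ^ k) ^ q * P N₀ ^ q     ≡⟨ cong (_* P N₀ ^ q) (^-swap (3 * M + 1) k q) ⟩
    ((3 * M + 1) ^ q) ^ k * P N₀ ^ q     ∎)
    where
    open ≤-Reasoning
    0<A : 0 < (3 * M + 1) ^ q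
    0<A = m^n>0 (3 * M + 1) {{>-nonZero (m≤n+m 1 (3 * M))}} q
    1≤xₙ : 1 ≤ xs (N₀ + k)
    1≤xₙ = ≤-trans 1≤M (large (N₀ + k) (m≤m+n N₀ k))

theorem4p2 : (a : ℕ → ℕ) → IsESequence a → NonPeriodic a →
    LimsupAboveLog₂3 a → ΩDivergent a
theorem4p2 a _ nonPeriodic (p , zero , () , _)
theorem4p2 a _ nonPeriodic (p , suc s , _ , 3^q<2^p , often) (_ , _ , _ , xs , _ , orbit) =
  injective-eventually-large xs (orbit-injective orbit nonPeriodic) (threshold s)
    λ (N₀ , large) → eventually-large-contradiction orbit {p = p} {q = suc s}
      (s≤s z≤n) (threshold-gap s p 3^q<2^p) large often
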